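{- Let $q$ be a prime power and let $\mathcal{A}$ be an essential free central hyperplane arrangement in $\mathbb{F}_q^3$ with exponents $(1, d_2, d_3)$. If $d_2\leq d_3$, then $d_2\leq q$.
   Context: A central hyperplane arrangement $\mathcal{A}$ in $V=\mathbb{F}_q^3$ is a finite set of 2-dimensional linear subspaces; it is essential if $\bigcap_{H\in\mathcal{A}}H=\{0\}$. Let $S=\mathbb{F}_q[x_1,x_2,x_3]$ be the polynomial ring of $V$, and for each $H\in\mathcal{A}$ fix a nonzero linear form $\alpha_H$ vanishing on $H$. Let $\mathrm{Der}_V=\bigoplus_i S\,\partial/\partial x_i$ be the $S$-module of polynomial vector fields. The module of logarithmic vector fields is $D(\mathcal{A})=\{\delta\in\mathrm{Der}_V : \delta(\alpha_H)\in\alpha_H S \text{ for all } H\in\mathcal{A}\}$. $\mathcal{A}$ is free if $D(\mathcal{A})$ is a free $S$-module; then it has a basis of homogeneous vector fields $\sum_i f_i\,\partial/\partial x_i$ (all $f_i$ homogeneous of a common degree $d$, the degree of the field), and the multiset of these degrees is the exponents of $\mathcal{A}$ (e.g. the Euler field $\sum_i x_i\partial/\partial x_i$ has degree $1$). -}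

module Defs where

open import Level using (0ℓ)
open import Algebra.Bundles using (CommutativeRing)
open import Data.Nat using (ℕ; zero; suc; _∸_; _<_; _^_) renaming (_+_ to _+ℕ_)
open import Data.Nat.Primality using (Prime)
open import Data.Fin using (Fin)
open import Data.Product using (_×_; _,_; ∃; Σ)
open import Data.List using (List)
open import Data.List.Relation.Unary.All using (All)
open import Data.List.Relation.Unary.AllPairs using (AllPairs)
open import Relation.Binary.PropositionalEquality using (_≡_; _≢_)
open import Relation.Nullary using (¬_)

IsPrimePower : ℕ → Set
IsPrimePower q = ∃ λ p → ∃ λ k → Prime p × (q ≡ p ^ suc k)

module Arr (R : CommutativeRing 0ℓ 0ℓ) where
  open CommutativeRing R using (_≈_; _+_; _*_; 0#; 1#) renaming (Carrier to F)

  IsField : Set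
  IsField = (¬ (1# ≈ 0#)) × (∀ x → ¬ (x ≈ 0#) → ∃ λ y → (x * y) ≈ 1#)

  -- R has exactly q elements (up to its equality ≈)
  HasOrder : ℕ → Set
  HasOrder q = Σ (Fin q → F) λ e →
    (∀ i j → e i ≈ e j → i ≡ j) × (∀ x → ∃ λ i → x ≈ e i)

  sumUpTo : ℕ → (ℕ → F) → F
  sumUpTo zero g = g zero
  sumUpTo (suc n) g = sumUpTo n g + g (suc n)

  -- monomials x1^a x2^b x3^c, encoded by exponent triples
  Mon : Set
  Mon = ℕ × ℕ × ℕ

  -- polynomials in S = F[x1,x2,x3]: coefficient functions with finite support
  Coeffs : Set
  Coeffs = Mon → F

  IsPoly : Coeffs → Set
  IsPoly f = ∃ λ N → ∀ a b c → N < a +ℕ b +ℕ c → f (a , b , c) ≈ 0#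

  Poly : Set
  Poly = Σ Coeffs IsPoly

  _≈P_ : Coeffs → Coeffs → Set
  f ≈P g = ∀ m → f m ≈ g m

  zeroP : Coeffs
  zeroP _ = 0#

  _+P_ : Coeffs → Coeffs → Coeffs
  (f +P g) m = f m + g m

  _·P_ : F → Coeffs → Coeffs
  (c ·P f) m = c * f m

  _*P_ : Coeffs → Coeffs → Coeffs
  (f *P g) (a , b , c) =
    sumUpTo a λ i → sumUpTo b λ j → sumUpTo c λ k →
      f (i , j , k) * g (a ∸ i , b ∸ j , c ∸ k)

  -- linear forms on V = F^3 (coefficient vectors) and their polynomials
  Form : Set
  Form = Fin 3 → F

  linPoly : Form → Coeffs
  linPoly α (1 , 0 , 0) = α Fin.zero
  linPoly α (0 , 1 , 0) = α (Fin.suc Fin.zero)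
  linPoly α (0 , 0 , 1) = α (Fin.suc (Fin.suc Fin.zero))
  linPoly α _ = 0#

  -- polynomial vector fields  sum_i f_i ∂/∂x_i  (components f_i)
  VF : Set
  VF = Fin 3 → Coeffs

  IsVF : VF → Set
  IsVF θ = ∀ i → IsPoly (θ i)

  applyVF : VF → Form → Coeffs
  applyVF θ α = ((α Fin.zero ·P θ Fin.zero) +P (α (Fin.suc Fin.zero) ·P θ (Fin.suc Fin.zero)))
                  +P (α (Fin.suc (Fin.suc Fin.zero)) ·P θ (Fin.suc (Fin.suc Fin.zero)))

  DivBy : Form → Coeffs → Set
  DivBy α g = ∃ λ h → IsPoly h × (g ≈P (linPoly α *P h))

  -- central arrangements: list of defining forms α_H, each nonzero,
  -- pairwise non-proportional (so the hyperplanes are distinct)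
  Arrangement : Set
  Arrangement = List Form

  NonzeroForm : Form → Set
  NonzeroForm α = ¬ (∀ i → α i ≈ 0#)

  NotProportional : Form → Form → Set
  NotProportional α β = ¬ (∃ λ c → ∀ i → α i ≈ (c * β i))

  IsArrangement : Arrangement → Set
  IsArrangement A = All NonzeroForm A × AllPairs NotProportional A

  eval : Form → (Fin 3 → F) → F
  eval α v = ((α Fin.zero * v Fin.zero) + (α (Fin.suc Fin.zero) * v (Fin.suc Fin.zero)))
               + (α (Fin.suc (Fin.suc Fin.zero)) * v (Fin.suc (Fin.suc Fin.zero)))

  Essential : Arrangement → Set
  Essential A = ∀ (v : Fin 3 → F) → All (λ α → eval α v ≈ 0#) A → ∀ i → v i ≈ 0#

  InD : Arrangement → VF → Set
  InD A θ = IsVF θ × All (λ α → DivBy α (applyVF θ α)) A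

  Homogeneous : ℕ → VF → Set
  Homogeneous d θ = ∀ i a b c → (a +ℕ b +ℕ c) ≢ d → θ i (a , b , c) ≈ 0#

  comb : Coeffs → VF → Coeffs → VF → Coeffs → VF → VF
  comb g₁ θ₁ g₂ θ₂ g₃ θ₃ i = ((g₁ *P θ₁ i) +P (g₂ *P θ₂ i)) +P (g₃ *P θ₃ i)

  FreeWithExponents : Arrangement → ℕ → ℕ → ℕ → Set
  FreeWithExponents A d₁ d₂ d₃ = ∃ λ θ₁ → ∃ λ θ₂ → ∃ λ θ₃ →
    (InD A θ₁ × InD A θ₂ × InD A θ₃) ×
    (Homogeneous d₁ θ₁ × Homogeneous d₂ θ₂ × Homogeneous d₃ θ₃) ×
    (∀ δ → InD A δ → ∃ λ g₁ → ∃ λ g₂ → ∃ λ g₃ →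
       IsPoly g₁ × IsPoly g₂ × IsPoly g₃ ×
       (∀ i → δ i ≈P comb g₁ θ₁ g₂ θ₂ g₃ θ₃ i)) ×
    (∀ g₁ g₂ g₃ → IsPoly g₁ → IsPoly g₂ → IsPoly g₃ →
       (∀ i → comb g₁ θ₁ g₂ θ₂ g₃ θ₃ i ≈P zeroP) →
       (g₁ ≈P zeroP) × (g₂ ≈P zeroP) × (g₃ ≈P zeroP))

-- Over a field with q = p^e elements, δ = x₁^q ∂₁ + x₂^q ∂₂ + x₃^q ∂₃ is logarithmic for every
-- arrangement: for a linear form α, the multinomial coefficients of degree q vanish mod p except at
-- the corners and αᵢ^q = αᵢ, so δ(α) = Σ αᵢ xᵢ^q = α^q = α · α^(q-1). If q < d₂ ≤ d₃, then in
-- δ = g₁θ₁ + g₂θ₂ + g₃θ₃ the last two terms have no monomials of degree q, so δ = g₁θ₁ with θ₁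
-- linear; x₁^q and x₂^q would then be multiples of g₁ by linear forms, which comparing a few
-- coefficients rules out.

module Submission where

open import Defs
open import Level using (0ℓ)
open import Algebra.Bundles using (CommutativeRing)
open import Data.Nat as ℕ using (ℕ; zero; suc; _≤_; _<_; s≤s; z≤n; nonTrivial⇒n>1)
open import Data.Nat.Properties using (*-mono-≤; m^n>0; ≮⇒≥; <-≤-trans)
open import Data.Nat.Primality using (Prime; prime⇒nonZero; prime⇒nonTrivial)
open import Data.Product using (_,_)
open import Relation.Nullary using (¬_)
open import Relation.Binary.PropositionalEquality as ≡ using (_≡_)

onPred : {A : Set} → A → (ℕ → A) → ℕ → A
onPred z f zero = z
onPred z f (suc n) = f n

module Multinomial where

  open import Data.Nat
  open import Data.Nat.Properties
  open import Data.Nat.Combinatorics using (_C_; nCk+nC[k+1]≡[n+1]C[k+1]; k>n⇒nCk≡0; nCn≡1; nC1≡n)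
  open import Data.Nat.Divisibility
  open import Data.Nat.Primality using (Prime; prime; euclidsLemma; prime⇒nonZero)
  open import Data.Nat.Tactic.RingSolver using (solve-∀)
  open import Data.Empty using (⊥-elim)
  open import Data.Sum using (inj₁; inj₂)
  open import Relation.Nullary using (¬_; yes; no)
  open import Relation.Binary.PropositionalEquality

  [n+1]C[k+1]≡nCk+nC[k+1] : ∀ n k → suc n C suc k ≡ n C k + n C suc k
  [n+1]C[k+1]≡nCk+nC[k+1] n k = sym (nCk+nC[k+1]≡[n+1]C[k+1] n k)

  [k+1]*[n+1]C[k+1]≡[n+1]*nCk : ∀ n k → suc k * (suc n C suc k) ≡ suc n * (n C k)
  [k+1]*[n+1]C[k+1]≡[n+1]*nCk zero zero = refl
  [k+1]*[n+1]C[k+1]≡[n+1]*nCk zero (suc k) =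
    trans (cong (suc (suc k) *_) (k>n⇒nCk≡0 {1} {suc (suc k)} (s≤s (s≤s z≤n)))) (*-zeroʳ (suc (suc k)))
  [k+1]*[n+1]C[k+1]≡[n+1]*nCk (suc n) zero =
    trans (*-identityˡ _) (trans (nC1≡n (suc (suc n))) (sym (*-identityʳ (suc (suc n)))))
  [k+1]*[n+1]C[k+1]≡[n+1]*nCk (suc n) (suc k) = begin
      suc (suc k) * (suc (suc n) C suc (suc k))
    ≡⟨ cong (suc (suc k) *_) ([n+1]C[k+1]≡nCk+nC[k+1] (suc n) (suc k)) ⟩
      suc (suc k) * (X + Y)
    ≡⟨ expand k X Y ⟩
      X + suc k * X + suc (suc k) * Y
    ≡⟨ cong₂ (λ u v → X + u + v) ([k+1]*[n+1]C[k+1]≡[n+1]*nCk n k) ([k+1]*[n+1]C[k+1]≡[n+1]*nCk n (suc k)) ⟩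
      X + suc n * (n C k) + suc n * (n C suc k)
    ≡⟨ collect n X (n C k) (n C suc k) ⟩
      X + suc n * (n C k + n C suc k)
    ≡⟨ cong (λ u → X + suc n * u) (sym ([n+1]C[k+1]≡nCk+nC[k+1] n k)) ⟩
      suc (suc n) * X ∎
    where
    open ≡-Reasoning
    expand : ∀ k X Y → suc (suc k) * (X + Y) ≡ X + suc k * X + suc (suc k) * Y
    expand = solve-∀
    collect : ∀ n X U V → X + suc n * U + suc n * V ≡ X + suc n * (U + V)
    collect = solve-∀
    X = suc n C suc k
    Y = suc n C suc (suc k)

  onPred-*ʳ : ∀ (f : ℕ → ℕ) x n → onPred 0 f n * x ≡ onPred 0 (λ m → f m * x) n
  onPred-*ʳ f x zero = refl
  onPred-*ʳ f x (suc n) = refl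

  onPred-*ˡ : ∀ (f : ℕ → ℕ) x n → x * onPred 0 f n ≡ onPred 0 (λ m → x * f m) n
  onPred-*ˡ f x zero = *-zeroʳ x
  onPred-*ˡ f x (suc n) = refl

  multinomial₂ : ℕ → ℕ → ℕ
  multinomial₂ b c = (b + c) C b

  multinomial₂-zeroʳ : ∀ b → multinomial₂ b 0 ≡ 1
  multinomial₂-zeroʳ b = trans (cong (_C b) (+-identityʳ b)) (nCn≡1 b)

  multinomial₂-pascal : ∀ b c → 0 < b + c →
    multinomial₂ b c ≡ onPred 0 (λ b′ → multinomial₂ b′ c) b + onPred 0 (multinomial₂ b) c
  multinomial₂-pascal (suc b) zero _ =
    trans (multinomial₂-zeroʳ (suc b)) (sym (cong (_+ 0) (multinomial₂-zeroʳ b)))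
  multinomial₂-pascal zero (suc c) _ = refl
  multinomial₂-pascal (suc b) (suc c) _ =
    trans ([n+1]C[k+1]≡nCk+nC[k+1] (b + suc c) b) (cong (λ n → (b + suc c) C b + n C suc b) (+-suc b c))

  multinomial₃ : ℕ → ℕ → ℕ → ℕ
  multinomial₃ a b c = multinomial₂ a (b + c) * multinomial₂ b c

  multinomial₃-pascal : ∀ a b c → 0 < a + b + c →
    multinomial₃ a b c ≡ onPred 0 (λ a′ → multinomial₃ a′ b c) a
                           + onPred 0 (λ b′ → multinomial₃ a b′ c) b
                           + onPred 0 (multinomial₃ a b) c
  multinomial₃-pascal a b c a+b+c>0 = begin
      multinomial₂ a (b + c) * multinomial₂ b c
    ≡⟨ cong (_* multinomial₂ b c) (multinomial₂-pascal a (b + c) (subst (0 <_) (+-assoc a b c) a+b+c>0)) ⟩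
      (lowerA + lowerBC) * multinomial₂ b c
    ≡⟨ *-distribʳ-+ (multinomial₂ b c) lowerA lowerBC ⟩
      lowerA * multinomial₂ b c + lowerBC * multinomial₂ b c
    ≡⟨ cong₂ _+_ (onPred-*ʳ _ (multinomial₂ b c) a) (split-bc b c) ⟩
      onPred 0 (λ a′ → multinomial₃ a′ b c) a + (onPred 0 (λ b′ → multinomial₃ a b′ c) b + onPred 0 (multinomial₃ a b) c)
    ≡⟨ sym (+-assoc (onPred 0 (λ a′ → multinomial₃ a′ b c) a) _ _) ⟩
      onPred 0 (λ a′ → multinomial₃ a′ b c) a + onPred 0 (λ b′ → multinomial₃ a b′ c) b
        + onPred 0 (multinomial₃ a b) c ∎
    where
    open ≡-Reasoning
    lowerA = onPred 0 (λ a′ → multinomial₂ a′ (b + c)) a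
    lowerBC = onPred 0 (multinomial₂ a) (b + c)
    split-bc⁺ : ∀ b c → 0 < b + c → multinomial₂ a (pred (b + c)) * multinomial₂ b c
                ≡ onPred 0 (λ b′ → multinomial₃ a b′ c) b + onPred 0 (multinomial₃ a b) c
    split-bc⁺ b c b+c>0 = begin
        m * multinomial₂ b c
      ≡⟨ cong (m *_) (multinomial₂-pascal b c b+c>0) ⟩
        m * (onPred 0 (λ b′ → multinomial₂ b′ c) b + onPred 0 (multinomial₂ b) c)
      ≡⟨ *-distribˡ-+ m (onPred 0 (λ b′ → multinomial₂ b′ c) b) (onPred 0 (multinomial₂ b) c) ⟩
        m * onPred 0 (λ b′ → multinomial₂ b′ c) b + m * onPred 0 (multinomial₂ b) c
      ≡⟨ cong₂ _+_ (onPred-*ˡ _ m b) (onPred-*ˡ _ m c) ⟩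
        onPred 0 (λ b′ → m * multinomial₂ b′ c) b + onPred 0 (λ c′ → m * multinomial₂ b c′) c
      ≡⟨ cong₂ _+_ (shift-b b) (shift-c c) ⟩
        onPred 0 (λ b′ → multinomial₃ a b′ c) b + onPred 0 (multinomial₃ a b) c ∎
      where
      m = multinomial₂ a (pred (b + c))
      shift-b : ∀ b₀ → onPred 0 (λ b′ → multinomial₂ a (pred (b₀ + c)) * multinomial₂ b′ c) b₀
                       ≡ onPred 0 (λ b′ → multinomial₃ a b′ c) b₀
      shift-b zero = refl
      shift-b (suc _) = refl
      shift-c : ∀ c₀ → onPred 0 (λ c′ → multinomial₂ a (pred (b + c₀)) * multinomial₂ b c′) c₀
                       ≡ onPred 0 (multinomial₃ a b) c₀
      shift-c zero = refl
      shift-c (suc c′) = cong (λ n → multinomial₂ a (pred n) * multinomial₂ b c′) (+-suc b c′)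
    split-bc : ∀ b c → onPred 0 (multinomial₂ a) (b + c) * multinomial₂ b c
               ≡ onPred 0 (λ b′ → multinomial₃ a b′ c) b + onPred 0 (multinomial₃ a b) c
    split-bc zero zero = refl
    split-bc (suc b) c = split-bc⁺ (suc b) c (s≤s z≤n)
    split-bc zero (suc c) = split-bc⁺ zero (suc c) (s≤s z≤n)

  n∣k*nCk : ∀ n k → n ∣ k * (n C k)
  n∣k*nCk zero zero = ∣-refl
  n∣k*nCk zero (suc k) = subst (0 ∣_) (sym (*-zeroʳ (suc k))) ∣-refl
  n∣k*nCk (suc n) zero = suc n ∣0
  n∣k*nCk (suc n) (suc k) = divides (n C k) (trans ([k+1]*[n+1]C[k+1]≡[n+1]*nCk n k) (*-comm (suc n) (n C k)))

  p^m∣j*x∧p^m∤j⇒p∣x : ∀ {p} → Prime p → ∀ m j x → p ^ m ∣ j * x → ¬ (p ^ m ∣ j) → p ∣ x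
  p^m∣j*x∧p^m∤j⇒p∣x pp zero j x _ p^0∤j = ⊥-elim (p^0∤j (1∣ j))
  p^m∣j*x∧p^m∤j⇒p∣x {p} pp@(prime _) (suc m) j x p^m∣jx p^m∤j with p ∣? j
  ... | no p∤j with euclidsLemma j x pp (∣-trans (m∣m*n (p ^ m)) p^m∣jx)
  ...   | inj₁ p∣j = ⊥-elim (p∤j p∣j)
  ...   | inj₂ p∣x = p∣x
  p^m∣j*x∧p^m∤j⇒p∣x {p} pp@(prime _) (suc m) .(j′ * p) x p^m∣jx p^m∤j | yes (divides j′ refl) =
    p^m∣j*x∧p^m∤j⇒p∣x pp m j′ x
      (*-cancelˡ-∣ p (subst (p * p ^ m ∣_) (trans (cong (_* x) (*-comm j′ p)) (*-assoc p j′ x)) p^m∣jx))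
      (λ p^m∣j′ → p^m∤j (subst (p * p ^ m ∣_) (*-comm p j′) (*-monoʳ-∣ p p^m∣j′)))
    where instance _ = prime⇒nonZero pp

  p∣[p^n]Ck : ∀ {p} → Prime p → ∀ n k → 0 < k → k < p ^ n → p ∣ (p ^ n) C k
  p∣[p^n]Ck pp n k k>0 k<p^n = p^m∣j*x∧p^m∤j⇒p∣x pp n k _ (n∣k*nCk (_ ^ n) k)
    λ p^n∣k → <⇒≱ k<p^n (∣⇒≤ {{>-nonZero k>0}} p^n∣k)

  p∣multinomial₃ : ∀ {p} → Prime p → ∀ n a b c → a + b + c ≡ p ^ n →
                   a ≢ p ^ n → b ≢ p ^ n → c ≢ p ^ n → p ∣ multinomial₃ a b c
  p∣multinomial₃ {p} pp n a@(suc _) b c sum≡ a≢ _ _ =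
    ∣m⇒∣m*n (multinomial₂ b c) (subst (λ t → p ∣ t C a) (sym total≡) (p∣[p^n]Ck pp n a (s≤s z≤n) a<p^n))
    where
    total≡ : a + (b + c) ≡ p ^ n
    total≡ = trans (sym (+-assoc a b c)) sum≡
    a<p^n : a < p ^ n
    a<p^n = ≤∧≢⇒< (subst (a ≤_) total≡ (m≤m+n a (b + c))) a≢
  p∣multinomial₃ pp n zero zero c sum≡ _ _ c≢ = ⊥-elim (c≢ sum≡)
  p∣multinomial₃ {p} pp n zero b@(suc _) c sum≡ _ b≢ _ =
    ∣n⇒∣m*n 1 (subst (λ t → p ∣ t C b) (sym sum≡) (p∣[p^n]Ck pp n b (s≤s z≤n) b<p^n))
    where
    b<p^n : b < p ^ n
    b<p^n = ≤∧≢⇒< (subst (b ≤_) sum≡ (m≤m+n b c)) b≢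

module Coefficients (R : CommutativeRing 0ℓ 0ℓ) where

  open CommutativeRing R renaming (Carrier to F)
  open Arr R
  open import Data.Nat using (_<_; _∸_) renaming (_+_ to _+ℕ_)
  open import Data.Nat.Properties using (≤-refl; m≤n⇒m≤1+n; m∸[m∸n]≡n; +-suc; <⇒≱; +-mono-≤; m∸n≤m; <-irrefl)
  open import Data.Fin using (Fin) renaming (zero to 𝟘; suc to 𝕤)
  open import Data.Product.Properties using (≡-dec)
  open import Data.Bool using (if_then_else_)
  open import Relation.Nullary using (Dec; does)
  open import Relation.Nullary.Decidable using (dec-true; dec-false)
  open import Relation.Binary.PropositionalEquality as ≡ using (_≢_)
  open import Relation.Binary.Reasoning.Setoid setoid

  deg : Mon → ℕ
  deg (a , b , c) = a +ℕ b +ℕ c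

  onPred-cong : ∀ k {f g : ℕ → F} → (∀ m → suc m ≡ k → f m ≈ g m) → onPred 0# f k ≈ onPred 0# g k
  onPred-cong zero _ = refl
  onPred-cong (suc k) f≈g = f≈g k ≡.refl

  onPred-zero : ∀ k {f : ℕ → F} → (∀ m → f m ≈ 0#) → onPred 0# f k ≈ 0#
  onPred-zero zero _ = refl
  onPred-zero (suc k) f≈0 = f≈0 k

  sumUpTo-cong : ∀ k {f g : ℕ → F} → (∀ i → i ≤ k → f i ≈ g i) → sumUpTo k f ≈ sumUpTo k g
  sumUpTo-cong zero f≈g = f≈g 0 z≤n
  sumUpTo-cong (suc k) f≈g = +-cong (sumUpTo-cong k (λ i i≤k → f≈g i (m≤n⇒m≤1+n i≤k))) (f≈g (suc k) ≤-refl)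

  sumUpTo-zero : ∀ k {f : ℕ → F} → (∀ i → i ≤ k → f i ≈ 0#) → sumUpTo k f ≈ 0#
  sumUpTo-zero zero f≈0 = f≈0 0 z≤n
  sumUpTo-zero (suc k) f≈0 =
    trans (+-cong (sumUpTo-zero k (λ i i≤k → f≈0 i (m≤n⇒m≤1+n i≤k))) (f≈0 (suc k) ≤-refl)) (+-identityʳ 0#)

  sumUpTo-suc : ∀ k (f : ℕ → F) → sumUpTo (suc k) f ≈ f 0 + sumUpTo k (λ i → f (suc i))
  sumUpTo-suc zero f = refl
  sumUpTo-suc (suc k) f = trans (+-congʳ (sumUpTo-suc k f)) (+-assoc (f 0) _ _)

  sumUpTo-reverse : ∀ k (f : ℕ → F) → sumUpTo k f ≈ sumUpTo k (λ i → f (k ∸ i))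
  sumUpTo-reverse zero f = refl
  sumUpTo-reverse (suc k) f = begin
    sumUpTo k f + f (suc k)                         ≈⟨ +-congʳ (sumUpTo-reverse k f) ⟩
    sumUpTo k (λ i → f (k ∸ i)) + f (suc k)         ≈⟨ +-comm _ (f (suc k)) ⟩
    f (suc k) + sumUpTo k (λ i → f (k ∸ i))         ≈⟨ sym (sumUpTo-suc k (λ i → f (suc k ∸ i))) ⟩
    sumUpTo (suc k) (λ i → f (suc k ∸ i))           ∎

  sumUpTo-reflect : ∀ k {f g : ℕ → F} → (∀ i → i ≤ k → f (k ∸ i) ≈ g i) → sumUpTo k f ≈ sumUpTo k g
  sumUpTo-reflect k {f} f≈g = trans (sumUpTo-reverse k f) (sumUpTo-cong k f≈g)

  sumUpTo-head : ∀ k {f : ℕ → F} → (∀ i → f (suc i) ≈ 0#) → sumUpTo k f ≈ f 0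
  sumUpTo-head zero _ = refl
  sumUpTo-head (suc k) f≈0 = trans (+-cong (sumUpTo-head k f≈0) (f≈0 k)) (+-identityʳ _)

  sumUpTo-convolve₁ : ∀ k (u : ℕ → ℕ → F) → (∀ i j → u (suc (suc i)) j ≈ 0#) →
                      sumUpTo k (λ i → u i (k ∸ i)) ≈ u 0 k + onPred 0# (u 1) k
  sumUpTo-convolve₁ zero u _ = sym (+-identityʳ _)
  sumUpTo-convolve₁ (suc k) u u≈0 =
    trans (sumUpTo-suc k _) (+-congˡ (sumUpTo-head k (λ i → u≈0 i (k ∸ suc i))))

  *P-congʳ : ∀ f {g h} → g ≈P h → (f *P g) ≈P (f *P h)
  *P-congʳ f g≈h (a , b , c) =
    sumUpTo-cong a λ i _ → sumUpTo-cong b λ j _ → sumUpTo-cong c λ k _ → *-congˡ (g≈h _)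

  *P-comm : ∀ f g → (f *P g) ≈P (g *P f)
  *P-comm f g (a , b , c) =
    sumUpTo-reflect a λ i i≤a → sumUpTo-reflect b λ j j≤b → sumUpTo-reflect c λ k k≤c →
      trans (*-comm _ _) (*-congʳ (reflexive
        (≡.cong₂ (λ x y → g (x , y)) (m∸[m∸n]≡n i≤a) (≡.cong₂ _,_ (m∸[m∸n]≡n j≤b) (m∸[m∸n]≡n k≤c)))))

  mulLin : Form → Coeffs → Coeffs
  mulLin α h (a , b , c) =
      onPred 0# (λ a′ → α 𝟘 * h (a′ , b , c)) a
    + onPred 0# (λ b′ → α (𝕤 𝟘) * h (a , b′ , c)) b
    + onPred 0# (λ c′ → α (𝕤 (𝕤 𝟘)) * h (a , b , c′)) c

  linPoly-*P : ∀ α h → (linPoly α *P h) ≈P mulLin α h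
  linPoly-*P α h (a , b , c) = begin
    sumUpTo a (λ i → U i (a ∸ i))
      ≈⟨ sumUpTo-convolve₁ a U (λ i a′ → sumUpTo-zero b λ j _ → sumUpTo-zero c λ k _ → zeroˡ _) ⟩
    U 0 a + onPred 0# (U 1) a
      ≈⟨ +-cong (sumUpTo-convolve₁ b V (λ j b′ → sumUpTo-zero c λ k _ → zeroˡ _))
                (onPred-cong a λ a′ _ → trans (sumUpTo-head b (λ j → sumUpTo-zero c λ k _ → zeroˡ _))
                                              (sumUpTo-head c (λ k → zeroˡ _))) ⟩
    (V 0 b + onPred 0# (V 1) b) + A
      ≈⟨ +-congʳ (+-cong (sumUpTo-convolve₁ c W (λ k c′ → zeroˡ _))
                         (onPred-cong b λ b′ _ → sumUpTo-head c (λ k → zeroˡ _))) ⟩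
    ((0# * h (a , b , c) + C) + B) + A
      ≈⟨ +-congʳ (+-congʳ (trans (+-congʳ (zeroˡ _)) (+-identityˡ C))) ⟩
    (C + B) + A
      ≈⟨ +-comm (C + B) A ⟩
    A + (C + B)
      ≈⟨ trans (+-congˡ (+-comm C B)) (sym (+-assoc A B C)) ⟩
    A + B + C
      ∎
    where
    U : ℕ → ℕ → F
    U i a′ = sumUpTo b λ j → sumUpTo c λ k → linPoly α (i , j , k) * h (a′ , b ∸ j , c ∸ k)
    V : ℕ → ℕ → F
    V j b′ = sumUpTo c λ k → linPoly α (0 , j , k) * h (a , b′ , c ∸ k)
    W : ℕ → ℕ → F
    W k c′ = linPoly α (0 , 0 , k) * h (a , b , c′)
    A = onPred 0# (λ a′ → α 𝟘 * h (a′ , b , c)) a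
    B = onPred 0# (λ b′ → α (𝕤 𝟘) * h (a , b′ , c)) b
    C = onPred 0# (λ c′ → α (𝕤 (𝕤 𝟘)) * h (a , b , c′)) c

  *P-linPoly : ∀ h α → (h *P linPoly α) ≈P mulLin α h
  *P-linPoly h α m = trans (*P-comm h (linPoly α) m) (linPoly-*P α h m)

  linearPart : VF → Fin 3 → Form
  linearPart θ i 𝟘 = θ i (1 , 0 , 0)
  linearPart θ i (𝕤 𝟘) = θ i (0 , 1 , 0)
  linearPart θ i (𝕤 (𝕤 𝟘)) = θ i (0 , 0 , 1)

  homogeneous₁⇒linPoly : ∀ {θ} → Homogeneous 1 θ → ∀ i → θ i ≈P linPoly (linearPart θ i)
  homogeneous₁⇒linPoly θ₁ i (0 , 0 , 0) = θ₁ i 0 0 0 (λ ())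
  homogeneous₁⇒linPoly θ₁ i (1 , 0 , 0) = refl
  homogeneous₁⇒linPoly θ₁ i (0 , 1 , 0) = refl
  homogeneous₁⇒linPoly θ₁ i (0 , 0 , 1) = refl
  homogeneous₁⇒linPoly θ₁ i (suc (suc a) , b , c) = θ₁ i (suc (suc a)) b c (λ ())
  homogeneous₁⇒linPoly θ₁ i (1 , suc b , c) = θ₁ i 1 (suc b) c (λ ())
  homogeneous₁⇒linPoly θ₁ i (1 , 0 , suc c) = θ₁ i 1 0 (suc c) (λ ())
  homogeneous₁⇒linPoly θ₁ i (0 , suc (suc b) , c) = θ₁ i 0 (suc (suc b)) c (λ ())
  homogeneous₁⇒linPoly θ₁ i (0 , 1 , suc c) = θ₁ i 0 1 (suc c) (λ ())
  homogeneous₁⇒linPoly θ₁ i (0 , 0 , suc (suc c)) = θ₁ i 0 0 (suc (suc c)) (λ ())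

  *P-homogeneous₁ : ∀ g {θ} → Homogeneous 1 θ → ∀ i → (g *P θ i) ≈P mulLin (linearPart θ i) g
  *P-homogeneous₁ g {θ} θ₁ i m = trans (*P-congʳ g (homogeneous₁⇒linPoly θ₁ i) m) (*P-linPoly g (linearPart θ i) m)

  *P-homogeneous-below : ∀ g {d θ} → Homogeneous d θ → ∀ i m → deg m < d → (g *P θ i) m ≈ 0#
  *P-homogeneous-below g θ-hom i (a , b , c) m<d =
    sumUpTo-zero a λ i′ _ → sumUpTo-zero b λ j _ → sumUpTo-zero c λ k _ →
      trans (*-congˡ (θ-hom i (a ∸ i′) (b ∸ j) (c ∸ k) λ deg≡d →
               <⇒≱ m<d (≡.subst (_≤ a +ℕ b +ℕ c) deg≡d
                 (+-mono-≤ (+-mono-≤ (m∸n≤m a i′) (m∸n≤m b j)) (m∸n≤m c k)))))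
            (zeroʳ _)

  mulLin-congAt : ∀ α {f g} m → (∀ m′ → suc (deg m′) ≡ deg m → f m′ ≈ g m′) → mulLin α f m ≈ mulLin α g m
  mulLin-congAt α (a , b , c) f≈g = +-cong (+-cong
    (onPred-cong a λ a′ 1+a′≡a → *-congˡ (f≈g _ (≡.cong (λ t → t +ℕ b +ℕ c) 1+a′≡a)))
    (onPred-cong b λ b′ 1+b′≡b → *-congˡ (f≈g _
      (≡.trans (≡.cong (_+ℕ c) (≡.sym (+-suc a b′))) (≡.cong (λ t → a +ℕ t +ℕ c) 1+b′≡b)))))
    (onPred-cong c λ c′ 1+c′≡c → *-congˡ (f≈g _
      (≡.trans (≡.sym (+-suc (a +ℕ b) c′)) (≡.cong (a +ℕ b +ℕ_) 1+c′≡c))))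

  mulLin-zeroP : ∀ α m → mulLin α zeroP m ≈ 0#
  mulLin-zeroP α (a , b , c) =
    trans (+-cong (+-cong (onPred-zero a λ _ → zeroʳ _) (onPred-zero b λ _ → zeroʳ _)) (onPred-zero c λ _ → zeroʳ _))
          (trans (+-identityʳ _) (+-identityʳ 0#))

  _≟ᴹ_ : (m m′ : Mon) → Dec (m ≡ m′)
  _≟ᴹ_ = ≡-dec ℕ._≟_ (≡-dec ℕ._≟_ ℕ._≟_)

  monomial : Mon → Coeffs
  monomial m₀ m = if does (m ≟ᴹ m₀) then 1# else 0#

  monomial-same : ∀ m → monomial m m ≈ 1#
  monomial-same m = reflexive (≡.cong (if_then 1# else 0#) (dec-true (m ≟ᴹ m) ≡.refl))

  monomial-other : ∀ m₀ m → m ≢ m₀ → monomial m₀ m ≈ 0#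
  monomial-other m₀ m m≢m₀ = reflexive (≡.cong (if_then 1# else 0#) (dec-false (m ≟ᴹ m₀) m≢m₀))

  monomial-isPoly : ∀ m₀ → IsPoly (monomial m₀)
  monomial-isPoly m₀ = deg m₀ , λ a b c m₀<m →
    monomial-other m₀ (a , b , c) λ m≡m₀ → <-irrefl (≡.sym (≡.cong deg m≡m₀)) m₀<m

  component : ℕ → Coeffs → Coeffs
  component k f m = if does (deg m ℕ.≟ k) then f m else 0#

  component-on : ∀ {k} f m → deg m ≡ k → component k f m ≈ f m
  component-on {k} f m deg≡k = reflexive (≡.cong (if_then f m else 0#) (dec-true (deg m ℕ.≟ k) deg≡k))

  component-off : ∀ {k} f m → deg m ≢ k → component k f m ≈ 0#
  component-off {k} f m deg≢k = reflexive (≡.cong (if_then f m else 0#) (dec-false (deg m ℕ.≟ k) deg≢k))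

  component-isPoly : ∀ k f → IsPoly (component k f)
  component-isPoly k f = k , λ a b c k<deg → component-off f (a , b , c) λ deg≡k → <-irrefl (≡.sym deg≡k) k<deg

  comb-lowDegree : ∀ g₁ θ₁ g₂ θ₂ g₃ θ₃ {d₂ d₃} → Homogeneous d₂ θ₂ → Homogeneous d₃ θ₃ →
                   ∀ i m → deg m < d₂ → deg m < d₃ → comb g₁ θ₁ g₂ θ₂ g₃ θ₃ i m ≈ (g₁ *P θ₁ i) m
  comb-lowDegree g₁ θ₁ g₂ θ₂ g₃ θ₃ hom₂ hom₃ i m m<d₂ m<d₃ =
    trans (+-cong (+-congˡ (*P-homogeneous-below g₂ hom₂ i m m<d₂)) (*P-homogeneous-below g₃ hom₃ i m m<d₃))
          (trans (+-identityʳ _) (+-identityʳ _))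

module Powers (R : CommutativeRing 0ℓ 0ℓ) where

  open CommutativeRing R renaming (Carrier to F)
  open Arr R
  open Coefficients R
  open import Algebra.Properties.CommutativeSemigroup *-commutativeSemigroup using (x∙yz≈y∙xz)
  open import Algebra.Properties.Semiring.Mult semiring using (_×_; ×-congʳ; ×-homo-+; ×-comm-*)
  open import Algebra.Properties.Semiring.Exp semiring using (_^_)
  open Multinomial using (multinomial₂; multinomial₂-zeroʳ; multinomial₃; multinomial₃-pascal)
  open import Data.Nat using (_<_; z≤n) renaming (_+_ to _+ℕ_)
  open import Data.Nat.Properties using (suc-injective; +-cancelˡ-≡; m+n≡0⇒m≡0; m+n≡0⇒n≡0)
    renaming (+-identityʳ to +-identityʳℕ; +-assoc to +-assocℕ; +-comm to +-commℕ)
  open import Data.Fin using (Fin) renaming (zero to 𝟘; suc to 𝕤)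
  open import Relation.Nullary using (yes; no)
  open import Relation.Binary.PropositionalEquality as ≡ using (_≢_)
  open import Relation.Binary.Reasoning.Setoid setoid

  evalMon : Form → Mon → F
  evalMon α (a , b , c) = α 𝟘 ^ a * (α (𝕤 𝟘) ^ b * α (𝕤 (𝕤 𝟘)) ^ c)

  -- the coefficient of x^m in α^(deg m)
  powerCoeff : Form → Coeffs
  powerCoeff α (a , b , c) = multinomial₃ a b c × evalMon α (a , b , c)

  onPred-× : ∀ (f : ℕ → ℕ) (E : ℕ → F) x k → (∀ m → E (suc m) ≈ x * E m) →
             onPred 0 f k × E k ≈ onPred 0# (λ m → x * (f m × E m)) k
  onPred-× f E x zero _ = refl
  onPred-× f E x (suc m) E-suc = trans (×-congʳ (f m) (E-suc m)) (sym (×-comm-* (f m) x (E m)))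

  powerCoeff-pascal : ∀ α m → 0 < deg m → powerCoeff α m ≈ mulLin α (powerCoeff α) m
  powerCoeff-pascal α (a , b , c) deg>0 = begin
    multinomial₃ a b c × E
      ≡⟨ ≡.cong (_× E) (multinomial₃-pascal a b c deg>0) ⟩
    (nA ℕ.+ nB ℕ.+ nC) × E
      ≈⟨ trans (×-homo-+ E (nA ℕ.+ nB) nC) (+-congʳ (×-homo-+ E nA nB)) ⟩
    nA × E + nB × E + nC × E
      ≈⟨ +-cong (+-cong (onPred-× _ (λ a′ → evalMon α (a′ , b , c)) _ a λ _ → *-assoc _ _ _)
                        (onPred-× _ (λ b′ → evalMon α (a , b′ , c)) _ b λ _ → shift₂ _ _ _ _))
                (onPred-× _ (λ c′ → evalMon α (a , b , c′)) _ c λ _ → shift₃ _ _ _ _) ⟩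
    mulLin α (powerCoeff α) (a , b , c)
      ∎
    where
    E = evalMon α (a , b , c)
    nA = onPred 0 (λ a′ → multinomial₃ a′ b c) a
    nB = onPred 0 (λ b′ → multinomial₃ a b′ c) b
    nC = onPred 0 (multinomial₃ a b) c
    shift₂ : ∀ x y u v → x * ((y * u) * v) ≈ y * (x * (u * v))
    shift₂ x y u v = trans (*-congˡ (*-assoc y u v)) (x∙yz≈y∙xz x y (u * v))
    shift₃ : ∀ x y z u → x * (y * (z * u)) ≈ z * (x * (y * u))
    shift₃ x y z u = trans (*-congˡ (x∙yz≈y∙xz y z u)) (x∙yz≈y∙xz x z (y * u))

  power : Form → ℕ → Coeffs
  power α k = component k (powerCoeff α)

  linPoly-*P-power : ∀ α k → (linPoly α *P power α k) ≈P power α (suc k)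
  linPoly-*P-power α k m with deg m ℕ.≟ suc k
  ... | yes deg≡1+k = begin
    (linPoly α *P power α k) m      ≈⟨ linPoly-*P α (power α k) m ⟩
    mulLin α (power α k) m          ≈⟨ mulLin-congAt α m (λ m′ 1+deg≡ →
                                         component-on (powerCoeff α) m′ (suc-injective (≡.trans 1+deg≡ deg≡1+k))) ⟩
    mulLin α (powerCoeff α) m       ≈⟨ sym (powerCoeff-pascal α m (≡.subst (0 <_) (≡.sym deg≡1+k) (ℕ.s≤s z≤n))) ⟩
    powerCoeff α m                  ≈⟨ sym (component-on (powerCoeff α) m deg≡1+k) ⟩
    power α (suc k) m               ∎
  ... | no deg≢1+k = begin
    (linPoly α *P power α k) m      ≈⟨ linPoly-*P α (power α k) m ⟩
    mulLin α (power α k) m          ≈⟨ mulLin-congAt α m (λ m′ 1+deg≡ → component-off (powerCoeff α) m′ λ deg≡k →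
                                         deg≢1+k (≡.trans (≡.sym 1+deg≡) (≡.cong suc deg≡k))) ⟩
    mulLin α zeroP m                ≈⟨ mulLin-zeroP α m ⟩
    0#                              ≈⟨ sym (component-off (powerCoeff α) m deg≢1+k) ⟩
    power α (suc k) m               ∎

  unitMon : Fin 3 → ℕ → Mon
  unitMon 𝟘 k = (k , 0 , 0)
  unitMon (𝕤 𝟘) k = (0 , k , 0)
  unitMon (𝕤 (𝕤 𝟘)) k = (0 , 0 , k)

  deg-unitMon : ∀ i k → deg (unitMon i k) ≡ k
  deg-unitMon 𝟘 k = ≡.trans (+-identityʳℕ (k +ℕ 0)) (+-identityʳℕ k)
  deg-unitMon (𝕤 𝟘) k = +-identityʳℕ k
  deg-unitMon (𝕤 (𝕤 𝟘)) k = ≡.refl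

  powerField : ℕ → VF
  powerField k i = monomial (unitMon i k)

  coord : Fin 3 → Mon → ℕ
  coord 𝟘 (a , _ , _) = a
  coord (𝕤 𝟘) (_ , b , _) = b
  coord (𝕤 (𝕤 𝟘)) (_ , _ , c) = c

  m+n≡m⇒n≡0 : ∀ m n → m +ℕ n ≡ m → n ≡ 0
  m+n≡m⇒n≡0 m n m+n≡m = +-cancelˡ-≡ m n 0 (≡.trans m+n≡m (≡.sym (+-identityʳℕ m)))

  coord≡deg⇒unitMon : ∀ i m {k} → deg m ≡ k → coord i m ≡ k → m ≡ unitMon i k
  coord≡deg⇒unitMon 𝟘 (a , b , c) deg≡k a≡k =
    ≡.cong₂ _,_ a≡k (≡.cong₂ _,_ (m+n≡0⇒m≡0 b b+c≡0) (m+n≡0⇒n≡0 b b+c≡0))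
    where
    b+c≡0 : b +ℕ c ≡ 0
    b+c≡0 = m+n≡m⇒n≡0 a (b +ℕ c) (≡.trans (≡.sym (+-assocℕ a b c)) (≡.trans deg≡k (≡.sym a≡k)))
  coord≡deg⇒unitMon (𝕤 𝟘) (a , b , c) deg≡k b≡k =
    ≡.cong₂ _,_ (m+n≡0⇒m≡0 a a+c≡0) (≡.cong₂ _,_ b≡k (m+n≡0⇒n≡0 a a+c≡0))
    where
    a+c≡0 : a +ℕ c ≡ 0
    a+c≡0 = m+n≡m⇒n≡0 b (a +ℕ c)
      (≡.trans (≡.sym (+-assocℕ b a c)) (≡.trans (≡.cong (_+ℕ c) (+-commℕ b a)) (≡.trans deg≡k (≡.sym b≡k))))
  coord≡deg⇒unitMon (𝕤 (𝕤 𝟘)) (a , b , c) deg≡k c≡k =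
    ≡.cong₂ _,_ (m+n≡0⇒m≡0 a a+b≡0) (≡.cong₂ _,_ (m+n≡0⇒n≡0 a a+b≡0) c≡k)
    where
    a+b≡0 : a +ℕ b ≡ 0
    a+b≡0 = m+n≡m⇒n≡0 c (a +ℕ b) (≡.trans (+-commℕ c (a +ℕ b)) (≡.trans deg≡k (≡.sym c≡k)))

  powerCoeff-unitMon : ∀ α i k → powerCoeff α (unitMon i k) ≈ α i ^ k
  powerCoeff-unitMon α 𝟘 k = begin
    (multinomial₂ k 0 ℕ.* 1) × (α 𝟘 ^ k * (1# * 1#))
      ≡⟨ ≡.cong (λ t → (t ℕ.* 1) × (α 𝟘 ^ k * (1# * 1#))) (multinomial₂-zeroʳ k) ⟩
    1 × (α 𝟘 ^ k * (1# * 1#))                      ≈⟨ +-identityʳ _ ⟩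
    α 𝟘 ^ k * (1# * 1#)                            ≈⟨ trans (*-congˡ (*-identityʳ 1#)) (*-identityʳ _) ⟩
    α 𝟘 ^ k                                        ∎
  powerCoeff-unitMon α (𝕤 𝟘) k = begin
    (1 ℕ.* multinomial₂ k 0) × (1# * (α (𝕤 𝟘) ^ k * 1#))
      ≡⟨ ≡.cong (λ t → (1 ℕ.* t) × (1# * (α (𝕤 𝟘) ^ k * 1#))) (multinomial₂-zeroʳ k) ⟩
    1 × (1# * (α (𝕤 𝟘) ^ k * 1#))                      ≈⟨ +-identityʳ _ ⟩
    1# * (α (𝕤 𝟘) ^ k * 1#)                            ≈⟨ trans (*-identityˡ _) (*-identityʳ _) ⟩
    α (𝕤 𝟘) ^ k                                        ∎
  powerCoeff-unitMon α (𝕤 (𝕤 𝟘)) k = trans (+-identityʳ _) (trans (*-identityˡ _) (*-identityˡ _))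

  applyVF-powerField-unitMon : ∀ α i k → applyVF (powerField (suc k)) α (unitMon i (suc k)) ≈ α i
  applyVF-powerField-unitMon α 𝟘 k =
    trans (+-cong (+-cong (*-congˡ (monomial-same x)) (*-congˡ (monomial-other y x λ ()))) (*-congˡ (monomial-other z x λ ())))
          (trans (+-cong (+-cong (*-identityʳ _) (zeroʳ _)) (zeroʳ _)) (trans (+-identityʳ _) (+-identityʳ _)))
    where x = unitMon 𝟘 (suc k); y = unitMon (𝕤 𝟘) (suc k); z = unitMon (𝕤 (𝕤 𝟘)) (suc k)
  applyVF-powerField-unitMon α (𝕤 𝟘) k =
    trans (+-cong (+-cong (*-congˡ (monomial-other x y λ ())) (*-congˡ (monomial-same y))) (*-congˡ (monomial-other z y λ ())))
          (trans (+-cong (+-cong (zeroʳ _) (*-identityʳ _)) (zeroʳ _)) (trans (+-identityʳ _) (+-identityˡ _)))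
    where x = unitMon 𝟘 (suc k); y = unitMon (𝕤 𝟘) (suc k); z = unitMon (𝕤 (𝕤 𝟘)) (suc k)
  applyVF-powerField-unitMon α (𝕤 (𝕤 𝟘)) k =
    trans (+-cong (+-cong (*-congˡ (monomial-other x z λ ())) (*-congˡ (monomial-other y z λ ()))) (*-congˡ (monomial-same z)))
          (trans (+-cong (+-cong (zeroʳ _) (zeroʳ _)) (*-identityʳ _)) (trans (+-congʳ (+-identityʳ _)) (+-identityˡ _)))
    where x = unitMon 𝟘 (suc k); y = unitMon (𝕤 𝟘) (suc k); z = unitMon (𝕤 (𝕤 𝟘)) (suc k)

  applyVF-powerField-elsewhere : ∀ α k m → (∀ i → m ≢ unitMon i k) → applyVF (powerField k) α m ≈ 0#
  applyVF-powerField-elsewhere α k m m≢ =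
    trans (+-cong (+-cong (*-congˡ (monomial-other (unitMon 𝟘 k) m (m≢ 𝟘)))
                          (*-congˡ (monomial-other (unitMon (𝕤 𝟘) k) m (m≢ (𝕤 𝟘)))))
                  (*-congˡ (monomial-other (unitMon (𝕤 (𝕤 𝟘)) k) m (m≢ (𝕤 (𝕤 𝟘))))))
          (trans (+-cong (+-cong (zeroʳ _) (zeroʳ _)) (zeroʳ _)) (trans (+-identityʳ _) (+-identityʳ 0#)))


module Field (R : CommutativeRing 0ℓ 0ℓ) (fld : Arr.IsField R) where

  open CommutativeRing R renaming (Carrier to F)
  open Arr R
  open Coefficients R
  open Powers R
  open import Data.Nat using () renaming (_+_ to _+ℕ_)
  open import Data.Nat.Properties using () renaming (+-comm to +-commℕ; +-identityʳ to +-identityʳℕ)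
  open import Data.Fin using () renaming (zero to 𝟘; suc to 𝕤)
  open import Relation.Binary.PropositionalEquality as ≡ using (_≡_)
  open import Data.Product using (_,_; proj₁; proj₂)
  open import Relation.Nullary using (¬_)
  open import Relation.Binary.Reasoning.Setoid setoid

  1#≉0# : ¬ 1# ≈ 0#
  1#≉0# = proj₁ fld

  *-cancelˡ-≉0 : ∀ {x y z} → ¬ x ≈ 0# → x * y ≈ x * z → y ≈ z
  *-cancelˡ-≉0 {x} {y} {z} x≉0 xy≈xz with proj₂ fld x x≉0
  ... | w , xw≈1 = begin
    y             ≈⟨ sym (*-identityˡ y) ⟩
    1# * y        ≈⟨ *-congʳ (trans (sym xw≈1) (*-comm x w)) ⟩
    (w * x) * y   ≈⟨ *-assoc w x y ⟩
    w * (x * y)   ≈⟨ *-congˡ xy≈xz ⟩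
    w * (x * z)   ≈⟨ sym (*-assoc w x z) ⟩
    (w * x) * z   ≈⟨ *-congʳ (trans (*-comm w x) xw≈1) ⟩
    1# * z        ≈⟨ *-identityˡ z ⟩
    z             ∎

  *-cancelʳ-≉0 : ∀ {x y z} → ¬ z ≈ 0# → x * z ≈ y * z → x ≈ y
  *-cancelʳ-≉0 {x} {y} {z} z≉0 xz≈yz = *-cancelˡ-≉0 z≉0 (trans (*-comm z x) (trans xz≈yz (*-comm y z)))

  x*y≈0⇒y≈0 : ∀ {x y} → ¬ x ≈ 0# → x * y ≈ 0# → y ≈ 0#
  x*y≈0⇒y≈0 {x} x≉0 xy≈0 = *-cancelˡ-≉0 x≉0 (trans xy≈0 (sym (zeroʳ x)))

  x*y≉0 : ∀ {x y} → ¬ x ≈ 0# → ¬ y ≈ 0# → ¬ x * y ≈ 0#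
  x*y≉0 x≉0 y≉0 xy≈0 = y≉0 (x*y≈0⇒y≈0 x≉0 xy≈0)

  x*y≈1⇒y≉0 : ∀ {x y} → x * y ≈ 1# → ¬ y ≈ 0#
  x*y≈1⇒y≉0 {x} xy≈1 y≈0 = 1#≉0# (trans (sym xy≈1) (trans (*-congˡ y≈0) (zeroʳ x)))

  -- If x^(k+1) = g ℓ₁ and y^(k+1) = g ℓ₂ with ℓ₁, ℓ₂ linear, the coefficient G of x^k in g is nonzero;
  -- comparing coefficients of x^(k+1) and x^k y in y^(k+1) = g ℓ₂ kills ℓ₂, a contradiction.
  module LinearMultiple (n : ℕ) (g : Coeffs) {θ : VF} (hom₁ : Homogeneous 1 θ)
    (δ≈gθ : ∀ i m → deg m ≡ suc (suc n) → powerField (suc (suc n)) i m ≈ (g *P θ i) m) where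

    k : ℕ
    k = suc n

    ℓ₁ ℓ₂ : Form
    ℓ₁ = linearPart θ 𝟘
    ℓ₂ = linearPart θ (𝕤 𝟘)

    G : F
    G = g (k , 0 , 0)

    δ≈ℓg : ∀ i m → deg m ≡ suc k → powerField (suc k) i m ≈ mulLin (linearPart θ i) g m
    δ≈ℓg i m deg≡ = trans (δ≈gθ i m deg≡) (*P-homogeneous₁ g hom₁ i m)

    coeff-x^[k+1]-in-δ₁ : 1# ≈ ℓ₁ 𝟘 * G
    coeff-x^[k+1]-in-δ₁ = trans (sym (monomial-same (suc k , 0 , 0)))
      (trans (δ≈ℓg 𝟘 (suc k , 0 , 0) (deg-unitMon 𝟘 (suc k))) (trans (+-identityʳ _) (+-identityʳ _)))

    G≉0 : ¬ G ≈ 0#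
    G≉0 = x*y≈1⇒y≉0 (sym coeff-x^[k+1]-in-δ₁)

    ℓ₂x≈0 : ℓ₂ 𝟘 ≈ 0#
    ℓ₂x≈0 = *-cancelʳ-≉0 G≉0 (begin
      ℓ₂ 𝟘 * G                                 ≈⟨ sym (trans (+-identityʳ _) (+-identityʳ _)) ⟩
      ℓ₂ 𝟘 * G + 0# + 0#                       ≈⟨ sym (δ≈ℓg (𝕤 𝟘) (suc k , 0 , 0) (deg-unitMon 𝟘 (suc k))) ⟩
      monomial (0 , suc k , 0) (suc k , 0 , 0) ≈⟨ monomial-other (0 , suc k , 0) (suc k , 0 , 0) (λ ()) ⟩
      0#                                       ≈⟨ sym (zeroˡ G) ⟩
      0# * G                                   ∎)

    ℓ₂y≈0 : ℓ₂ (𝕤 𝟘) ≈ 0#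
    ℓ₂y≈0 = *-cancelʳ-≉0 G≉0 (begin
      ℓ₂ (𝕤 𝟘) * G                              ≈⟨ sym (+-identityˡ _) ⟩
      0# + ℓ₂ (𝕤 𝟘) * G                         ≈⟨ +-congʳ (sym (trans (*-congʳ ℓ₂x≈0) (zeroˡ _))) ⟩
      ℓ₂ 𝟘 * g (n , 1 , 0) + ℓ₂ (𝕤 𝟘) * G        ≈⟨ sym (+-identityʳ _) ⟩
      ℓ₂ 𝟘 * g (n , 1 , 0) + ℓ₂ (𝕤 𝟘) * G + 0#   ≈⟨ sym (δ≈ℓg (𝕤 𝟘) (k , 1 , 0) deg-x^ky) ⟩
      monomial (0 , suc k , 0) (k , 1 , 0)     ≈⟨ monomial-other (0 , suc k , 0) (k , 1 , 0) (λ ()) ⟩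
      0#                                       ≈⟨ sym (zeroˡ G) ⟩
      0# * G                                   ∎)
      where
      deg-x^ky : k +ℕ 1 +ℕ 0 ≡ suc k
      deg-x^ky = ≡.trans (+-identityʳℕ (k +ℕ 1)) (+-commℕ k 1)

    1≈0 : 1# ≈ 0#
    1≈0 = begin
      1#                        ≈⟨ sym (monomial-same (0 , suc k , 0)) ⟩
      powerField (suc k) (𝕤 𝟘) (0 , suc k , 0)
        ≈⟨ δ≈ℓg (𝕤 𝟘) (0 , suc k , 0) (deg-unitMon (𝕤 𝟘) (suc k)) ⟩
      0# + ℓ₂ (𝕤 𝟘) * g (0 , k , 0) + 0#
        ≈⟨ trans (+-identityʳ _) (+-identityˡ _) ⟩
      ℓ₂ (𝕤 𝟘) * g (0 , k , 0)  ≈⟨ *-congʳ ℓ₂y≈0 ⟩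
      0# * g (0 , k , 0)        ≈⟨ zeroˡ _ ⟩
      0#                        ∎

  powerField-not-multiple : ∀ n g {θ} → Homogeneous 1 θ →
    ¬ (∀ i m → deg m ≡ suc (suc n) → powerField (suc (suc n)) i m ≈ (g *P θ i) m)
  powerField-not-multiple n g hom₁ δ≈gθ = 1#≉0# (LinearMultiple.1≈0 n g hom₁ δ≈gθ)

module FiniteField (R : CommutativeRing 0ℓ 0ℓ) (fld : Arr.IsField R) (n : ℕ) (ord : Arr.HasOrder R (suc n)) where

  open CommutativeRing R renaming (Carrier to F)
  open import Algebra.Properties.Semiring.Mult semiring using (_×_; ×1-homo-*)
  open import Algebra.Properties.Semiring.Exp semiring using (_^_)
  open import Algebra.Properties.Group +-group using (identityʳ-unique)
  import Algebra.Properties.CommutativeMonoid.Sum as Sum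
  module Σ = Sum +-commutativeMonoid
  module Π = Sum *-commutativeMonoid
  open import Data.Fin as Fin using (Fin; punchIn)
  open import Function using (_∘_)
  open import Data.Fin.Properties using (punchInᵢ≢i) renaming (_≟_ to _≟ᶠ_)
  open import Data.Fin.Permutation using (Permutation′; permutation)
  open import Data.Product using (_,_; proj₁; proj₂)
  open import Relation.Nullary using (¬_; Dec; yes; no; contradiction)
  open import Relation.Binary.PropositionalEquality as ≡ using (_≡_)
  open import Relation.Binary.Reasoning.Setoid setoid

  open Field R fld using (1#≉0#; *-cancelʳ-≉0; x*y≈0⇒y≈0; x*y≉0)

  q : ℕ
  q = suc n

  e : Fin q → F
  e = proj₁ ord

  e-injective : ∀ i j → e i ≈ e j → i ≡ j
  e-injective = proj₁ (proj₂ ord)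

  index : F → Fin q
  index x = proj₁ (proj₂ (proj₂ ord) x)

  e-index : ∀ x → e (index x) ≈ x
  e-index x = sym (proj₂ (proj₂ (proj₂ ord) x))

  _≈?_ : ∀ x y → Dec (x ≈ y)
  x ≈? y with index x ≟ᶠ index y
  ... | yes i≡j = yes (trans (sym (e-index x)) (trans (reflexive (≡.cong e i≡j)) (e-index y)))
  ... | no i≢j = no λ x≈y → i≢j (e-injective _ _ (trans (e-index x) (trans x≈y (sym (e-index y)))))

  x^[1+k]≈0⇒x≈0 : ∀ {x} k → x ^ suc k ≈ 0# → x ≈ 0#
  x^[1+k]≈0⇒x≈0 {x} zero x¹≈0 = trans (sym (*-identityʳ x)) x¹≈0
  x^[1+k]≈0⇒x≈0 {x} (suc k) x^[2+k]≈0 with x ≈? 0#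
  ... | yes x≈0 = x≈0
  ... | no x≉0 = x^[1+k]≈0⇒x≈0 k (x*y≈0⇒y≈0 x≉0 x^[2+k]≈0)

  ×1-homo-^ : ∀ m k → (m ℕ.^ k) × 1# ≈ (m × 1#) ^ k
  ×1-homo-^ m zero = +-identityʳ 1#
  ×1-homo-^ m (suc k) = trans (×1-homo-* m (m ℕ.^ k)) (*-congˡ (×1-homo-^ m k))

  shuffle : (F → F) → Fin q → Fin q
  shuffle h i = index (h (e i))

  permutationOf : (h h⁻¹ : F → F) → (∀ {x y} → x ≈ y → h x ≈ h y) → (∀ {x y} → x ≈ y → h⁻¹ x ≈ h⁻¹ y) →
                  (∀ x → h (h⁻¹ x) ≈ x) → (∀ x → h⁻¹ (h x) ≈ x) → Permutation′ q
  permutationOf h h⁻¹ h-cong h⁻¹-cong hh⁻¹ h⁻¹h = permutation (shuffle h) (shuffle h⁻¹) inverseˡ inverseʳ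
    where
    inverseˡ : ∀ i → shuffle h (shuffle h⁻¹ i) ≡ i
    inverseˡ i = e-injective _ _ (trans (e-index _) (trans (h-cong (e-index _)) (hh⁻¹ (e i))))
    inverseʳ : ∀ i → shuffle h⁻¹ (shuffle h i) ≡ i
    inverseʳ i = e-injective _ _ (trans (e-index _) (trans (h⁻¹-cong (e-index _)) (h⁻¹h (e i))))

  q×1≈0 : q × 1# ≈ 0#
  q×1≈0 = identityʳ-unique S (q × 1#) (sym (begin
    S                                        ≈⟨ Σ.∑-permute e translation ⟩
    Σ.sum {q} (λ i → e (shuffle (_+ 1#) i))  ≈⟨ Σ.sum-cong-≋ {q} (λ i → e-index (e i + 1#)) ⟩
    Σ.sum {q} (λ i → e i + 1#)               ≈⟨ Σ.∑-distrib-+ e (λ _ → 1#) ⟩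
    S + Σ.sum {q} (λ _ → 1#)                 ≈⟨ +-congˡ (Σ.sum-replicate q) ⟩
    S + q × 1#                               ∎))
    where
    S = Σ.sum e
    translation : Permutation′ q
    translation = permutationOf (_+ 1#) (_- 1#) (+-congʳ) (+-congʳ)
      (λ x → trans (+-assoc x (- 1#) 1#) (trans (+-congˡ (-‿inverseˡ 1#)) (+-identityʳ x)))
      (λ x → trans (+-assoc x 1# (- 1#)) (trans (+-congˡ (-‿inverseʳ 1#)) (+-identityʳ x)))

  p×1≈0 : ∀ p k → q ≡ p ℕ.^ suc k → p × 1# ≈ 0#
  p×1≈0 p k q≡p^[1+k] = x^[1+k]≈0⇒x≈0 k (begin
    (p × 1#) ^ suc k     ≈⟨ sym (×1-homo-^ p (suc k)) ⟩
    (p ℕ.^ suc k) × 1#   ≡⟨ ≡.cong (_× 1#) (≡.sym q≡p^[1+k]) ⟩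
    q × 1#               ≈⟨ q×1≈0 ⟩
    0#                   ∎)

  orOne : F → F
  orOne x with x ≈? 0#
  ... | yes _ = 1#
  ... | no _ = x

  orOne-≈0 : ∀ {x} → x ≈ 0# → orOne x ≈ 1#
  orOne-≈0 {x} x≈0 with x ≈? 0#
  ... | yes _ = refl
  ... | no x≉0 = contradiction x≈0 x≉0

  orOne-≉0 : ∀ {x} → ¬ x ≈ 0# → orOne x ≈ x
  orOne-≉0 {x} x≉0 with x ≈? 0#
  ... | yes x≈0 = contradiction x≈0 x≉0
  ... | no _ = refl

  orOne≉0 : ∀ x → ¬ orOne x ≈ 0#
  orOne≉0 x with x ≈? 0#
  ... | yes _ = 1#≉0#
  ... | no x≉0 = x≉0

  ∏≉0 : ∀ {m} (f : Fin m → F) → (∀ i → ¬ f i ≈ 0#) → ¬ Π.sum f ≈ 0#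
  ∏≉0 {zero} f _ = 1#≉0#
  ∏≉0 {suc m} f f≉0 = x*y≉0 (f≉0 Fin.zero) (∏≉0 (f ∘ Fin.suc) (f≉0 ∘ Fin.suc))

  e-punchIn≉0 : ∀ j → ¬ e (punchIn (index 0#) j) ≈ 0#
  e-punchIn≉0 j e≈0 = punchInᵢ≢i (index 0#) j (e-injective _ _ (trans e≈0 (sym (e-index 0#))))

  -- Multiplication by a permutes the field; orOne keeps the products over it nonzero, and
  -- ∏ a · orOne (e i) and ∏ orOne (a · e i) differ exactly by the factor a at the index of 0.
  x≉0⇒x^q≈x : ∀ {a} → ¬ a ≈ 0# → a ^ q ≈ a
  x≉0⇒x^q≈x {a} a≉0 with proj₂ fld a a≉0
  ... | a⁻¹ , aa⁻¹≈1 = *-cancelʳ-≉0 (∏≉0 (orOne ∘ e) (orOne≉0 ∘ e)) (begin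
    a ^ q * P                                           ≈⟨ *-congʳ (sym (Π.sum-replicate q)) ⟩
    Π.sum {q} (λ _ → a) * P                             ≈⟨ sym (Π.∑-distrib-+ (λ _ → a) (orOne ∘ e)) ⟩
    Π.sum {q} (λ i → a * orOne (e i))                   ≈⟨ splitAtZero (λ i → a * orOne (e i)) scaled-at-zero scaled-elsewhere ⟩
    a * Q                                               ≈⟨ *-congˡ (sym (*-identityˡ Q)) ⟩
    a * (1# * Q)
      ≈⟨ *-congˡ (sym (splitAtZero (λ i → orOne (e (shuffle (a *_) i))) shuffled-at-zero shuffled-elsewhere)) ⟩
    a * Π.sum {q} (λ i → orOne (e (shuffle (a *_) i)))  ≈⟨ *-congˡ (sym (Π.∑-permute (orOne ∘ e) scaling)) ⟩
    a * P                                               ∎)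
    where
    z = index 0#
    P = Π.sum (orOne ∘ e)
    Q = Π.sum {n} (λ j → a * e (punchIn z j))

    splitAtZero : ∀ (t : Fin q → F) {c} → t z ≈ c → (∀ j → t (punchIn z j) ≈ a * e (punchIn z j)) → Π.sum t ≈ c * Q
    splitAtZero t tz≈c t≈ = trans (Π.sum-remove {i = z} t) (*-cong tz≈c (Π.sum-cong-≋ t≈))

    scaled-at-zero : a * orOne (e z) ≈ a
    scaled-at-zero = trans (*-congˡ (orOne-≈0 (e-index 0#))) (*-identityʳ a)

    scaled-elsewhere : ∀ j → a * orOne (e (punchIn z j)) ≈ a * e (punchIn z j)
    scaled-elsewhere j = *-congˡ (orOne-≉0 (e-punchIn≉0 j))

    shuffled-at-zero : orOne (e (shuffle (a *_) z)) ≈ 1#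
    shuffled-at-zero = orOne-≈0 (trans (e-index _) (trans (*-congˡ (e-index 0#)) (zeroʳ a)))

    shuffled-elsewhere : ∀ j → orOne (e (shuffle (a *_) (punchIn z j))) ≈ a * e (punchIn z j)
    shuffled-elsewhere j =
      trans (orOne-≉0 λ e≈0 → x*y≉0 a≉0 (e-punchIn≉0 j) (trans (sym (e-index _)) e≈0)) (e-index _)

    scaling : Permutation′ q
    scaling = permutationOf (a *_) (a⁻¹ *_) *-congˡ *-congˡ
      (λ x → trans (sym (*-assoc a a⁻¹ x)) (trans (*-congʳ aa⁻¹≈1) (*-identityˡ x)))
      (λ x → trans (sym (*-assoc a⁻¹ a x)) (trans (*-congʳ (trans (*-comm a⁻¹ a) aa⁻¹≈1)) (*-identityˡ x)))

  x^q≈x : ∀ a → a ^ q ≈ a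
  x^q≈x a with a ≈? 0#
  ... | yes a≈0 = trans (*-congʳ a≈0) (trans (zeroˡ (a ^ n)) (sym a≈0))
  ... | no a≉0 = x≉0⇒x^q≈x a≉0

module Frobenius (R : CommutativeRing 0ℓ 0ℓ) (fld : Arr.IsField R) (n : ℕ) (ord : Arr.HasOrder R (suc n))
                 {p e : ℕ} (pp : Prime p) (q≡p^[1+e] : suc n ≡ p ℕ.^ suc e) where

  open CommutativeRing R
  open Arr R
  open Coefficients R
  open Powers R
  open FiniteField R fld n ord using (q; x^q≈x; p×1≈0)
  open import Algebra.Properties.Semiring.Mult semiring using (_×_; ×-congʳ; ×-assoc-*; ×1-homo-*)
  open import Algebra.Properties.Semiring.Exp semiring using (_^_)
  open import Data.Nat.Divisibility using (_∣_; divides)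
  open import Data.Fin using () renaming (zero to 𝟘; suc to 𝕤)
  open import Data.Fin.Properties using (any?)
  open import Data.List.Relation.Unary.All using (universal)
  open import Data.Product using (_,_)
  open import Relation.Nullary using (yes; no)
  open import Relation.Binary.PropositionalEquality as ≡ using (_≡_; _≢_)
  open Multinomial using (multinomial₃; p∣multinomial₃)
  open import Relation.Binary.Reasoning.Setoid setoid

  p∣t⇒t×x≈0 : ∀ {t} → p ∣ t → ∀ x → t × x ≈ 0#
  p∣t⇒t×x≈0 {t} (divides d ≡.refl) x = begin
    t × x                         ≈⟨ ×-congʳ t (sym (*-identityˡ x)) ⟩
    t × (1# * x)                  ≈⟨ sym (×-assoc-* t 1# x) ⟩
    (t × 1#) * x                  ≈⟨ *-congʳ (×1-homo-* d p) ⟩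
    ((d × 1#) * (p × 1#)) * x     ≈⟨ *-congʳ (*-congˡ (p×1≈0 p e q≡p^[1+e])) ⟩
    ((d × 1#) * 0#) * x           ≈⟨ trans (*-congʳ (zeroʳ _)) (zeroˡ x) ⟩
    0#                            ∎

  powerCoeff≈applyVF-powerField : ∀ α m → deg m ≡ q → powerCoeff α m ≈ applyVF (powerField q) α m
  powerCoeff≈applyVF-powerField α m@(a , b , c) deg≡q with any? (λ i → m ≟ᴹ unitMon i q)
  ... | yes (i , m≡unit) = begin
    powerCoeff α m                            ≡⟨ ≡.cong (powerCoeff α) m≡unit ⟩
    powerCoeff α (unitMon i q)                ≈⟨ powerCoeff-unitMon α i q ⟩
    α i ^ q                                   ≈⟨ x^q≈x (α i) ⟩
    α i                                       ≈⟨ sym (applyVF-powerField-unitMon α i n) ⟩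
    applyVF (powerField q) α (unitMon i q)    ≡⟨ ≡.cong (applyVF (powerField q) α) (≡.sym m≡unit) ⟩
    applyVF (powerField q) α m                ∎
  ... | no m≢unit = begin
    powerCoeff α m                            ≈⟨ p∣t⇒t×x≈0 p∣multinomial (evalMon α m) ⟩
    0#                                        ≈⟨ sym (applyVF-powerField-elsewhere α q m λ i m≡unit → m≢unit (i , m≡unit)) ⟩
    applyVF (powerField q) α m                ∎
    where
    coord≢q : ∀ i → coord i m ≢ p ℕ.^ suc e
    coord≢q i coord≡ = m≢unit (i , coord≡deg⇒unitMon i m deg≡q (≡.trans coord≡ (≡.sym q≡p^[1+e])))
    p∣multinomial : p ∣ multinomial₃ a b c
    p∣multinomial = p∣multinomial₃ pp (suc e) a b c (≡.trans deg≡q q≡p^[1+e])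
                      (coord≢q 𝟘) (coord≢q (𝕤 𝟘)) (coord≢q (𝕤 (𝕤 𝟘)))

  applyVF-powerField≈power : ∀ α → applyVF (powerField q) α ≈P power α q
  applyVF-powerField≈power α m with deg m ℕ.≟ q
  ... | yes deg≡q = trans (sym (powerCoeff≈applyVF-powerField α m deg≡q)) (sym (component-on (powerCoeff α) m deg≡q))
  ... | no deg≢q = trans (applyVF-powerField-elsewhere α q m λ i m≡unit →
                                  deg≢q (≡.trans (≡.cong deg m≡unit) (deg-unitMon i q)))
                         (sym (component-off (powerCoeff α) m deg≢q))

  powerField-inD : ∀ A → InD A (powerField q)
  powerField-inD A = (λ i → monomial-isPoly (unitMon i q)) , universal α∣αδ A
    where
    α∣αδ : ∀ α → DivBy α (applyVF (powerField q) α)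
    α∣αδ α = power α n , component-isPoly n (powerCoeff α) ,
             λ m → trans (applyVF-powerField≈power α m) (sym (linPoly-*P-power α n m))

2≤p^[1+e] : ∀ {p} → Prime p → ∀ e → 2 ≤ p ℕ.^ suc e
2≤p^[1+e] {p} pp e = *-mono-≤ (nonTrivial⇒n>1 p {{prime⇒nonTrivial pp}}) (m^n>0 p {{prime⇒nonZero pp}} e)

module FrobeniusBound (R : CommutativeRing 0ℓ 0ℓ) (fld : Arr.IsField R) (n : ℕ) (ord : Arr.HasOrder R (suc (suc n)))
                     {p e : ℕ} (pp : Prime p) (q≡p^[1+e] : suc (suc n) ≡ p ℕ.^ suc e) where

  open CommutativeRing R using (trans)
  open Arr R
  open Coefficients R
  open Powers R
  open Field R fld using (powerField-not-multiple)
  open Frobenius R fld (suc n) ord {p} {e} pp q≡p^[1+e] using (powerField-inD)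

  q : ℕ
  q = suc (suc n)

  q≮d₂ : ∀ A {d₂ d₃} → FreeWithExponents A 1 d₂ d₃ → d₂ ≤ d₃ → ¬ q < d₂
  q≮d₂ A {d₂} (θ₁ , θ₂ , θ₃ , _ , (hom₁ , hom₂ , hom₃) , generates , _) d₂≤d₃ q<d₂
    with generates (powerField q) (powerField-inD A)
  ... | g₁ , g₂ , g₃ , _ , _ , _ , δ≈comb = powerField-not-multiple n g₁ hom₁ λ i m deg≡q →
    trans (δ≈comb i m)
          (comb-lowDegree g₁ θ₁ g₂ θ₂ g₃ θ₃ hom₂ hom₃ i m (deg<d₂ m deg≡q) (<-≤-trans (deg<d₂ m deg≡q) d₂≤d₃))
    where
    deg<d₂ : ∀ m → deg m ≡ q → deg m < d₂
    deg<d₂ m deg≡q = ≡.subst (_< d₂) (≡.sym deg≡q) q<d₂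

q≮d₂ : ∀ (R : CommutativeRing 0ℓ 0ℓ) → Arr.IsField R →
  ∀ q → 2 ≤ q → Arr.HasOrder R q → ∀ {p e} → Prime p → q ≡ p ℕ.^ suc e →
  ∀ A {d₂ d₃} → Arr.FreeWithExponents R A 1 d₂ d₃ → d₂ ≤ d₃ → ¬ q < d₂
q≮d₂ R fld (suc (suc n)) (s≤s (s≤s z≤n)) ord {p} {e} pp q≡p^[1+e] =
  FrobeniusBound.q≮d₂ R fld n ord {p} {e} pp q≡p^[1+e]

mainTheorem4 : (R : CommutativeRing 0ℓ 0ℓ) → (q : ℕ) → IsPrimePower q →
    let open Arr R in
    IsField → HasOrder q →
    (A : Arrangement) → IsArrangement A → Essential A →
    (d₂ d₃ : ℕ) → FreeWithExponents A 1 d₂ d₃ → d₂ ≤ d₃ → d₂ ≤ q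
mainTheorem4 R q (p , e , pp , q≡p^[1+e]) fld ord A _ _ d₂ d₃ free d₂≤d₃ =
  ≮⇒≥ (q≮d₂ R fld q 2≤q ord {p} {e} pp q≡p^[1+e] A free d₂≤d₃)
  where
  2≤q : 2 ≤ q
  2≤q = ≡.subst (2 ≤_) (≡.sym q≡p^[1+e]) (2≤p^[1+e] pp e)
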